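{- Let $A$ be a set. In atomic sheaves on $\mathbb{S}\mathsf{ur}$, the atomic equivalence $\sim_{\mathsf{NV}(A)}$ coincides with equiextension: for every object $\Omega$ and all functions $X,X'\colon\Omega\to A$, there exist an object $\Omega''$ and surjections $u,u'\colon\Omega''\to\Omega$ with $X\circ u = X'\circ u'$ if and only if $X(\Omega) = X'(\Omega)$.
   Context: $\mathbb{S}\mathsf{ur}$ is the category of nonempty finite sets and surjections. $\mathsf{NV}(A)$ is the sheaf on $\mathbb{S}\mathsf{ur}$ with $\mathsf{NV}(A)(\Omega)$ the functions $\Omega\to A$ and restriction by precomposition. For an atomic sheaf $P$ on a coconfluent category, $\sim_P(X) = \{(x,x')\mid \exists Z\,\exists u,u'\colon Z\to X.\ x\cdot u = x'\cdot u'\}$. -}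

module Defs where

open import Level using (Level)
open import Data.Nat using (ℕ; suc)
open import Data.Fin using (Fin)
open import Data.Product using (Σ; ∃; _×_; _,_)
open import Relation.Binary.PropositionalEquality using (_≡_)
open import Function using (_∘_)

-- Objects of Sur: nonempty finite sets, represented (up to isomorphism)
-- by Fin (suc n).
Obj : Set
Obj = ℕ

⟦_⟧ : Obj → Set
⟦ n ⟧ = Fin (suc n)

IsSurj : {X Y : Set} → (X → Y) → Set
IsSurj {X} {Y} f = ∀ (y : Y) → ∃ λ (x : X) → f x ≡ y

Sur : Obj → Obj → Set
Sur m n = Σ (⟦ m ⟧ → ⟦ n ⟧) IsSurj

NV : ∀ {a} → Set a → Obj → Set a
NV A Ω = ⟦ Ω ⟧ → A

restrict : ∀ {a} {A : Set a} {Ω Ω'' : Obj} → NV A Ω → Sur Ω'' Ω → NV A Ω''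
restrict x (u , _) = x ∘ u

∼NV : ∀ {a} (A : Set a) (Ω : Obj) → NV A Ω → NV A Ω → Set a
∼NV A Ω X X' = Σ Obj λ Ω'' → Σ (Sur Ω'' Ω) λ u → Σ (Sur Ω'' Ω) λ u' →
  ∀ (i : ⟦ Ω'' ⟧) → restrict X u i ≡ restrict X' u' i

_∈Im_ : ∀ {a} {A : Set a} {Ω : Obj} → A → NV A Ω → Set a
_∈Im_ {Ω = Ω} y X = ∃ λ (i : ⟦ Ω ⟧) → X i ≡ y

SameImage : ∀ {a} {A : Set a} {Ω : Obj} → NV A Ω → NV A Ω → Set a
SameImage {A = A} X X' = ∀ (y : A) → (y ∈Im X → y ∈Im X') × (y ∈Im X' → y ∈Im X)

-- If X ∘ u = X' ∘ u' with u surjective, every value X i = X (u k) = X' (u' k) is a value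
-- of X'; both legs being surjective, the images agree. Conversely, equal images give
-- s, s' with X' ∘ s = X and X ∘ s' = X', and on Ω ⊔ Ω the surjections [id , s'] and
-- [s , id] satisfy X ∘ [id , s'] = X' ∘ [s , id].
module Submission where

open import Defs
open import Data.Nat using (suc; _+_)
open import Data.Fin using (Fin; splitAt; _↑ˡ_; _↑ʳ_)
open import Data.Fin.Properties using (splitAt-↑ˡ; splitAt-↑ʳ)
open import Data.Product using (Σ; ∃; _×_; _,_; proj₁; proj₂)
open import Data.Sum using (inj₁; inj₂; [_,_])
open import Function using (id; _∘_)
open import Relation.Binary.PropositionalEquality using (_≡_; refl; sym; trans; cong)

Im-⊆ : ∀ {a} {A : Set a} {I J : Set} → (I → A) → (J → A) → Set a
Im-⊆ {A = A} X X' = ∀ (y : A) → (∃ λ i → X i ≡ y) → ∃ λ j → X' j ≡ y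

span-Im-⊆ : ∀ {a} {A : Set a} {I J K : Set} {X : I → A} {X' : J → A}
            (u : K → I) (u' : K → J) → IsSurj u →
            (∀ k → X (u k) ≡ X' (u' k)) → Im-⊆ X X'
span-Im-⊆ {X = X} u u' u-surj eq y (i , Xi≡y) =
  let (k , uk≡i) = u-surj i
  in u' k , trans (sym (eq k)) (trans (cong X uk≡i) Xi≡y)

Im-⊆⇒lift : ∀ {a} {A : Set a} {I J : Set} {X : I → A} {X' : J → A} →
            Im-⊆ X X' → Σ (I → J) λ s → ∀ i → X' (s i) ≡ X i
Im-⊆⇒lift {X = X} X⊆X' = (λ i → proj₁ (X⊆X' (X i) (i , refl)))
                         , (λ i → proj₂ (X⊆X' (X i) (i , refl)))

[id,_]∘splitAt-surjective : ∀ {m n} (f : Fin n → Fin m) → IsSurj ([ id , f ] ∘ splitAt m)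
[id,_]∘splitAt-surjective {m} {n} f i = i ↑ˡ n , cong [ id , f ] (splitAt-↑ˡ m i n)

[_,id]∘splitAt-surjective : ∀ {m n} (f : Fin m → Fin n) → IsSurj ([ f , id ] ∘ splitAt m)
[_,id]∘splitAt-surjective {m} {n} f i = m ↑ʳ i , cong [ f , id ] (splitAt-↑ʳ m n i)

lifts⇒∼NV : ∀ {a} {A : Set a} {Ω : Obj} {X X' : NV A Ω}
            (s s' : ⟦ Ω ⟧ → ⟦ Ω ⟧) →
            (∀ i → X' (s i) ≡ X i) → (∀ i → X (s' i) ≡ X' i) → ∼NV A Ω X X'
lifts⇒∼NV {Ω = Ω} {X} {X'} s s' X's≗X Xs'≗X' =
  Ω + suc Ω , (u , [id, s' ]∘splitAt-surjective) , (u' , [ s ,id]∘splitAt-surjective) , square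
  where
  u u' : Fin (suc Ω + suc Ω) → ⟦ Ω ⟧
  u  = [ id , s' ] ∘ splitAt (suc Ω)
  u' = [ s , id ] ∘ splitAt (suc Ω)

  square : ∀ k → X (u k) ≡ X' (u' k)
  square k with splitAt (suc Ω) k
  ... | inj₁ i = sym (X's≗X i)
  ... | inj₂ i = Xs'≗X' i

proposition5p2 : ∀ {a} (A : Set a) (Ω : Obj) (X X' : NV A Ω) →
    (∼NV A Ω X X' → SameImage X X') × (SameImage X X' → ∼NV A Ω X X')
proposition5p2 A Ω X X' = ∼⇒SameImage , SameImage⇒∼
  where
  ∼⇒SameImage : ∼NV A Ω X X' → SameImage X X'
  ∼⇒SameImage (_ , (u , u-surj) , (u' , u'-surj) , eq) y =
    span-Im-⊆ u u' u-surj eq y , span-Im-⊆ u' u u'-surj (sym ∘ eq) y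

  SameImage⇒∼ : SameImage X X' → ∼NV A Ω X X'
  SameImage⇒∼ same =
    let (s , X's≗X) = Im-⊆⇒lift (λ y → proj₁ (same y))
        (s' , Xs'≗X') = Im-⊆⇒lift (λ y → proj₂ (same y))
    in lifts⇒∼NV s s' X's≗X Xs'≗X'
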